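{- Let $n\ge 1$. The set of totally symmetric self-complementary plane partitions inside a $2n\times 2n\times 2n$ box is in bijection with the set $SST_n$ of semistandard Young tableaux $y=(y_{i,j})$ of staircase shape $\delta_n=(n,n-1,\dots,2,1)$ with all entries at most $n$ and satisfying $y_{i,j}\le y_{i-1,j+1}+1$ whenever both entries are defined.
   Context: A plane partition inside a $2n\times 2n\times 2n$ box is an array $t=(t_{i,j})_{1\le i,j\le 2n}$ of integers in $\{0,1,\dots,2n\}$ that weakly decrease along rows and down columns; equivalently the set of unit cubes $\{(i,j,k): 1\le k\le t_{i,j}\}$. It is totally symmetric if this set of cubes is invariant under all permutations of the three coordinates, and self-complementary if $t_{i,j}+t_{2n+1-i,2n+1-j}=2n$ for all $i,j$. A semistandard Young tableau of staircase shape $\delta_n$ is an array $(y_{i,j})$, $1\le i\le n$, $1\le j\le n+1-i$, of positive integers weakly increasing from left to right along rows and strictly increasing from top to bottom down columns. -}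

module Defs where

open import Data.Nat using (ℕ; zero; suc; _+_; _*_; _∸_; _≤_; _<_)
open import Data.Fin using (Fin) renaming (zero to fz; suc to fs)
open import Data.Fin.Permutation using (Permutation′; _⟨$⟩ʳ_)
open import Data.Product using (Σ; _×_; _,_; proj₁; proj₂)
open import Function.Base using (_∘_)
open import Function.Bundles using (_⇔_; Inverse)
open import Relation.Binary.Bundles using (Setoid)
open import Relation.Binary.PropositionalEquality using (_≡_; refl; sym; trans)

-- Conventions: all indices are 0-based natural numbers.
-- An array t : ℕ → ℕ → ℕ represents (t_{i,j}) via t_{i+1,j+1} = t i j;
-- values outside the relevant index range are irrelevant (arrays are
-- compared only on the relevant cells).

IsPP-box : ℕ → (ℕ → ℕ → ℕ) → Set
IsPP-box m t =
    (∀ i j → i < m → j < m → t i j ≤ m)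
  × (∀ i j j′ → i < m → j′ < m → j ≤ j′ → t i j′ ≤ t i j)
  × (∀ i i′ j → i′ < m → j < m → i ≤ i′ → t i′ j ≤ t i j)

-- the unit cube with (0-based) coordinates c 0, c 1, c 2 belongs to t
-- (i.e. 1-based cube (i,j,k) with 1 ≤ k ≤ t_{i,j})
Cube : ℕ → (ℕ → ℕ → ℕ) → (Fin 3 → ℕ) → Set
Cube m t c = c (fz) < m × c (fs fz) < m
           × c (fs (fs fz)) < t (c fz) (c (fs fz))

TotallySymmetric : ℕ → (ℕ → ℕ → ℕ) → Set
TotallySymmetric m t =
  ∀ (σ : Permutation′ 3) (c : Fin 3 → ℕ) → Cube m t c ⇔ Cube m t (c ∘ (σ ⟨$⟩ʳ_))

-- t_{i,j} + t_{2n+1-i,2n+1-j} = 2n  (0-based: complement index m ∸ suc i)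
SelfComplementary : ℕ → (ℕ → ℕ → ℕ) → Set
SelfComplementary m t =
  ∀ i j → i < m → j < m → t i j + t (m ∸ suc i) (m ∸ suc j) ≡ m

IsTSSCPP : ℕ → (ℕ → ℕ → ℕ) → Set
IsTSSCPP n t = IsPP-box (2 * n) t × TotallySymmetric (2 * n) t
             × SelfComplementary (2 * n) t

TSSCPP : ℕ → Set
TSSCPP n = Σ (ℕ → ℕ → ℕ) (IsTSSCPP n)

_≈PP[_]_ : {n : ℕ} → TSSCPP n → ℕ → TSSCPP n → Set
s ≈PP[ n ] u = ∀ i j → i < 2 * n → j < 2 * n → proj₁ s i j ≡ proj₁ u i j

TSSCPP-setoid : ℕ → Setoid _ _
TSSCPP-setoid n = record
  { Carrier = TSSCPP n
  ; _≈_ = λ s u → _≈PP[_]_ {n} s n u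
  ; isEquivalence = record
    { refl = λ i j _ _ → refl
    ; sym = λ p i j a b → sym (p i j a b)
    ; trans = λ p q i j a b → trans (p i j a b) (q i j a b)
    }
  }

InStaircase : ℕ → ℕ → ℕ → Set
InStaircase n i j = i + j < n

IsSST : ℕ → (ℕ → ℕ → ℕ) → Set
IsSST n y =
    (∀ i j → InStaircase n i j → 1 ≤ y i j)
  × (∀ i j j′ → InStaircase n i j′ → j ≤ j′ → y i j ≤ y i j′)
  × (∀ i i′ j → InStaircase n i′ j → i < i′ → y i j < y i′ j)

-- SST_n : entries at most n and y_{i,j} ≤ y_{i-1,j+1} + 1 whenever
-- both entries are defined (0-based: cells (i+1,j) and (i,j+1))
IsSSTn : ℕ → (ℕ → ℕ → ℕ) → Set
IsSSTn n y =
    IsSST n y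
  × (∀ i j → InStaircase n i j → y i j ≤ n)
  × (∀ i j → InStaircase n (suc i) j → y (suc i) j ≤ y i (suc j) + 1)

SSTn : ℕ → Set
SSTn n = Σ (ℕ → ℕ → ℕ) (IsSSTn n)

SSTn-setoid : ℕ → Setoid _ _
SSTn-setoid n = record
  { Carrier = SSTn n
  ; _≈_ = λ s u → ∀ i j → InStaircase n i j → proj₁ s i j ≡ proj₁ u i j
  ; isEquivalence = record
    { refl = λ i j _ → refl
    ; sym = λ p i j a → sym (p i j a)
    ; trans = λ p q i j a → trans (p i j a) (q i j a)
    }
  }

-- A TSSCPP t is determined by its values on the quadrant n ≤ p, q < 2n.  Using
-- total symmetry and self-complementarity, every cube (a, b, c) of the box can be
-- permuted or mirrored into one with at least two coordinates ≥ n, and such a cube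
-- (p, q, c) with c < n is present iff c < t p q; cubes with all coordinates < n
-- are always present, those with all ≥ n never.  On the quadrant t is symmetric,
-- weakly decreasing and t p q ≤ 2n − 1 − p (indices from 0), and in 1-based
-- notation the substitution y_{i,j} = t_{2n+2−i−j, 2n+1−j} + i turns exactly these
-- constraints on the half p ≤ q into the conditions defining SST_n; conversely any
-- such quadrant data, extended to the cube set by the rule above, is a TSSCPP.

module Submission where

open import Defs
open import Data.Bool using (Bool; true; false; if_then_else_; not; T)
open import Data.Bool.Properties using (not-involutive; T-≡)
open import Data.Empty using (⊥-elim)
open import Data.Fin using (Fin)
open import Data.Fin.Patterns using (0F; 1F; 2F)
open import Data.Fin.Permutation using (Permutation′; _⟨$⟩ʳ_; transpose)
open import Data.Nat using (ℕ; zero; suc; _+_; _*_; _∸_; _≤_; _<_; _≤ᵇ_; _<ᵇ_; z≤n; s≤s; s≤s⁻¹; _<?_; _≤?_)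
open import Data.Nat.Properties
open import Data.Nat.Solver using (module +-*-Solver)
open import Data.Product using (_×_; _,_; proj₁; proj₂)
open import Data.Sum using (inj₁; inj₂)
open import Data.Unit using (tt)
open import Data.Vec using (_∷_; []; lookup)
open import Function.Base using (_∘_)
open import Function.Bundles using (Inverse; Injection; Equivalence; _⇔_; mk⇔)
open import Function.Properties.Inverse using (Inverse⇒Injection)
import Function.Properties.Equivalence as ⇔
open import Relation.Binary.Bundles using (Setoid)
open import Relation.Binary.Definitions using (tri<; tri≈; tri>)
open import Relation.Binary.PropositionalEquality
open import Relation.Nullary using (¬_; yes; no)

open +-*-Solver using (solve; _:+_; _:=_; con)
open Equivalence using (to; from)

count : (ℕ → Bool) → ℕ → ℕ
count P zero    = zero
count P (suc k) = if P k then suc (count P k) else count P k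

count≤ : ∀ P K → count P K ≤ K
count≤ P zero = z≤n
count≤ P (suc K) with P K
... | true  = s≤s (count≤ P K)
... | false = m≤n⇒m≤1+n (count≤ P K)

count-mono : ∀ P Q K → (∀ {k} → k < K → T (P k) → T (Q k)) → count P K ≤ count Q K
count-mono P Q zero    P⇒Q = z≤n
count-mono P Q (suc K) P⇒Q with P K in p | Q K in q
... | true  | true  = s≤s (count-mono P Q K (P⇒Q ∘ m≤n⇒m≤1+n))
... | false | true  = m≤n⇒m≤1+n (count-mono P Q K (P⇒Q ∘ m≤n⇒m≤1+n))
... | false | false = count-mono P Q K (P⇒Q ∘ m≤n⇒m≤1+n)
... | true  | false = ⊥-elim (subst T q (P⇒Q ≤-refl (subst T (sym p) tt)))

count-full : ∀ P K → (∀ {k} → k < K → T (P k)) → count P K ≡ K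
count-full P zero    all = refl
count-full P (suc K) all with P K | all ≤-refl
... | true  | _  = cong suc (count-full P K (all ∘ m≤n⇒m≤1+n))
... | false | ()

DownClosed : (ℕ → Bool) → ℕ → Set
DownClosed P K = ∀ {j k} → j ≤ k → k < K → T (P k) → T (P j)

<count⇔ : ∀ P K → DownClosed P K → ∀ {k} → k < K → (k < count P K ⇔ T (P k))
<count⇔ P (suc K) closed {k} k<1+K with P K in p
... | true  = mk⇔ (λ _ → closed (s≤s⁻¹ k<1+K) ≤-refl PK)
                 (λ _ → subst (k <_) (sym (cong suc (count-full P K λ j<K → closed (<⇒≤ j<K) ≤-refl PK))) k<1+K)
  where PK = subst T (sym p) tt
... | false with m≤n⇒m<n∨m≡n (s≤s⁻¹ k<1+K)
...   | inj₁ k<K  = <count⇔ P K (λ j≤k k<K → closed j≤k (m≤n⇒m≤1+n k<K)) k<K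
...   | inj₂ refl = mk⇔ (λ k<c → ⊥-elim (<⇒≱ k<c (count≤ P K))) (λ PK → ⊥-elim (subst T p PK))

≡-by-lower-sets : ∀ {K x y} → x ≤ K → y ≤ K → (∀ {k} → k < K → (k < x ⇔ k < y)) → x ≡ y
≡-by-lower-sets x≤K y≤K same = ≤-antisym
  (≮⇒≥ (λ y<x → <-irrefl refl (to (same (<-≤-trans y<x x≤K)) y<x)))
  (≮⇒≥ (λ x<y → <-irrefl refl (from (same (<-≤-trans x<y y≤K)) x<y)))

T-not⇔¬T : ∀ {b} → T (not b) ⇔ (¬ T b)
T-not⇔¬T {true}  = mk⇔ (λ ()) (λ ¬⊤ → ¬⊤ tt)
T-not⇔¬T {false} = mk⇔ (λ _ ()) (λ _ → tt)

T⇔¬T-not : ∀ {b} → T b ⇔ (¬ T (not b))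
T⇔¬T-not {b} = subst (λ c → T c ⇔ (¬ T (not b))) (not-involutive b) T-not⇔¬T

¬-cong-⇔ : ∀ {A B : Set} → A ⇔ B → (¬ A) ⇔ (¬ B)
¬-cong-⇔ A⇔B = mk⇔ (λ ¬a b → ¬a (from A⇔B b)) (λ ¬b a → ¬b (to A⇔B a))

<ᵇ⇔< : ∀ {a b} → T (a <ᵇ b) ⇔ a < b
<ᵇ⇔< {a} {b} = mk⇔ (<ᵇ⇒< a b) <⇒<ᵇ

<ᵇ-mono : ∀ {x x′ z z′} → x′ ≤ x → z ≤ z′ → T (x <ᵇ z) → T (x′ <ᵇ z′)
<ᵇ-mono x′≤x z≤z′ x<z = <⇒<ᵇ (≤-<-trans x′≤x (<-≤-trans (<ᵇ⇒< _ _ x<z) z≤z′))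

≮ᵇ-mono : ∀ {x x′ z z′} → x ≤ x′ → z′ ≤ z → T (not (x <ᵇ z)) → T (not (x′ <ᵇ z′))
≮ᵇ-mono x≤x′ z′≤z x≮z = from T-not⇔¬T (to T-not⇔¬T x≮z ∘ <ᵇ-mono x≤x′ z′≤z)

≤ᵇ-true : ∀ {x y} → x ≤ y → (x ≤ᵇ y) ≡ true
≤ᵇ-true x≤y = to T-≡ (≤⇒≤ᵇ x≤y)

≤ᵇ-false : ∀ {x y} → y < x → (x ≤ᵇ y) ≡ false
≤ᵇ-false {x} {y} y<x with x ≤ᵇ y in eq
... | false = refl
... | true  = ⊥-elim (<⇒≱ y<x (≤ᵇ⇒≤ x y (subst T (sym eq) tt)))

module Mirror (n : ℕ) where

  m : ℕ
  m = 2 * n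

  m≡n+n : m ≡ n + n
  m≡n+n = cong (n +_) (+-identityʳ n)

  n≤m : n ≤ m
  n≤m = subst (n ≤_) (sym m≡n+n) (m≤m+n n n)

  mirror : ℕ → ℕ
  mirror x = m ∸ suc x

  mirror+suc : ∀ {x} → x < m → mirror x + suc x ≡ m
  mirror+suc = m∸n+n≡m

  mirror-≡ : ∀ {x y} → y + suc x ≡ m → mirror x ≡ y
  mirror-≡ {x} {y} e = trans (cong (_∸ suc x) (sym e)) (m+n∸n≡m y (suc x))

  mirror<m : ∀ {x} → x < m → mirror x < m
  mirror<m {x} x<m = ∸-monoʳ-< {m} {suc x} {0} (s≤s z≤n) x<m

  mirror-involutive : ∀ {x} → x < m → mirror (mirror x) ≡ x
  mirror-involutive {x} x<m = mirror-≡ (begin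
    x + suc (mirror x)  ≡⟨ +-suc x (mirror x) ⟩
    suc (x + mirror x)  ≡⟨ cong suc (+-comm x (mirror x)) ⟩
    suc (mirror x + x)  ≡⟨ sym (+-suc (mirror x) x) ⟩
    mirror x + suc x    ≡⟨ mirror+suc x<m ⟩
    m                   ∎)
    where open ≡-Reasoning

  mirror-antitone : ∀ {x y} → x ≤ y → mirror y ≤ mirror x
  mirror-antitone x≤y = ∸-monoʳ-≤ m (s≤s x≤y)

  low⇒mirror-high : ∀ {x} → x < n → n ≤ mirror x
  low⇒mirror-high {x} x<n =
    subst (_≤ mirror x) (trans (cong (_∸ n) m≡n+n) (m+n∸n≡m n n)) (∸-monoʳ-≤ m x<n)

  high⇒mirror-low : ∀ {x} → n ≤ x → x < m → mirror x < n
  high⇒mirror-low {x} n≤x x<m = ≰⇒> λ n≤mx → <-irrefl refl (begin-strict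
    n + n              ≤⟨ +-monoˡ-≤ n n≤mx ⟩
    mirror x + n       <⟨ +-monoʳ-< (mirror x) (s≤s n≤x) ⟩
    mirror x + suc x   ≡⟨ mirror+suc x<m ⟩
    m                  ≡⟨ m≡n+n ⟩
    n + n              ∎)
    where open ≤-Reasoning

  <⇔¬mirror< : ∀ {a b k} → a + b ≡ m → k < m → (k < a ⇔ (¬ mirror k < b))
  <⇔¬mirror< {a} {b} {k} a+b≡m k<m = mk⇔
    (λ k<a mk<b → <-irrefl refl (begin-strict
      m                 ≡⟨ sym (mirror+suc k<m) ⟩
      mirror k + suc k  ≤⟨ +-monoʳ-≤ (mirror k) k<a ⟩
      mirror k + a      <⟨ +-monoˡ-< a mk<b ⟩
      b + a             ≡⟨ +-comm b a ⟩
      a + b             ≡⟨ a+b≡m ⟩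
      m                 ∎))
    (λ mk≮b → +-cancelʳ-≤ (mirror k) (suc k) a (begin
      suc k + mirror k  ≡⟨ +-comm (suc k) (mirror k) ⟩
      mirror k + suc k  ≡⟨ mirror+suc k<m ⟩
      m                 ≡⟨ sym a+b≡m ⟩
      a + b             ≤⟨ +-monoʳ-≤ a (≮⇒≥ mk≮b) ⟩
      a + mirror k      ∎))
    where open ≤-Reasoning

  -- The staircase cell (i, j) corresponds to the cell (mirror (i + j), mirror j)
  -- of the quadrant n ≤ p ≤ q < 2n.
  mirror-∸ : ∀ {i j} → i + j < m → mirror j ∸ mirror (i + j) ≡ i
  mirror-∸ {i} {j} i+j<m = begin
    mirror j ∸ mirror (i + j)             ≡⟨ cong (_∸ mirror (i + j)) (mirror-≡ sum) ⟩
    i + mirror (i + j) ∸ mirror (i + j)   ≡⟨ m+n∸n≡m i (mirror (i + j)) ⟩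
    i                                     ∎
    where
    open ≡-Reasoning
    sum : i + mirror (i + j) + suc j ≡ m
    sum = trans (solve 3 (λ i p j → i :+ p :+ (con 1 :+ j) := p :+ (con 1 :+ (i :+ j))) refl
                       i (mirror (i + j)) j)
                (mirror+suc i+j<m)

  quadrant-sum : ∀ {p q} → p ≤ q → q < m → p + suc (q ∸ p + mirror q) ≡ m
  quadrant-sum {p} {q} p≤q q<m = begin
    p + suc (q ∸ p + mirror q)  ≡⟨ solve 3 (λ p d c → p :+ (con 1 :+ (d :+ c)) := c :+ (con 1 :+ (d :+ p))) refl
                                     p (q ∸ p) (mirror q) ⟩
    mirror q + suc (q ∸ p + p)  ≡⟨ cong (λ x → mirror q + suc x) (m∸n+n≡m p≤q) ⟩
    mirror q + suc q            ≡⟨ mirror+suc q<m ⟩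
    m                           ∎
    where open ≡-Reasoning

  mirror-quadrant : ∀ {p q} → p ≤ q → q < m → mirror (q ∸ p + mirror q) ≡ p
  mirror-quadrant p≤q q<m = mirror-≡ (quadrant-sum p≤q q<m)

  quadrant⇒staircase : ∀ {p q} → n ≤ p → p ≤ q → q < m → q ∸ p + mirror q < n
  quadrant⇒staircase {p} {q} n≤p p≤q q<m = +-cancelˡ-≤ n _ n (begin
    n + suc (q ∸ p + mirror q)  ≤⟨ +-monoˡ-≤ _ n≤p ⟩
    p + suc (q ∸ p + mirror q)  ≡⟨ quadrant-sum p≤q q<m ⟩
    m                           ≡⟨ m≡n+n ⟩
    n + n                       ∎)
    where open ≤-Reasoning

module _ (Q : ℕ → ℕ → ℕ → Set)
         (swap₀₁ : ∀ {a b c} → Q a b c → Q b a c)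
         (swap₁₂ : ∀ {a b c} → Q a b c → Q a c b) where

  private
    rearrange : ∀ (d : Fin 3 → ℕ) i j k → i ≢ j → i ≢ k → j ≢ k →
                Q (d 0F) (d 1F) (d 2F) ⇔ Q (d i) (d j) (d k)
    rearrange d 0F 1F 2F _ _ _ = ⇔.refl
    rearrange d 0F 2F 1F _ _ _ = mk⇔ swap₁₂ swap₁₂
    rearrange d 1F 0F 2F _ _ _ = mk⇔ swap₀₁ swap₀₁
    rearrange d 1F 2F 0F _ _ _ = mk⇔ (λ x → swap₁₂ (swap₀₁ x)) (λ x → swap₀₁ (swap₁₂ x))
    rearrange d 2F 0F 1F _ _ _ = mk⇔ (λ x → swap₀₁ (swap₁₂ x)) (λ x → swap₁₂ (swap₀₁ x))
    rearrange d 2F 1F 0F _ _ _ = mk⇔ (λ x → swap₀₁ (swap₁₂ (swap₀₁ x)))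
                                     (λ x → swap₀₁ (swap₁₂ (swap₀₁ x)))
    rearrange d 0F 0F _  i≢j _ _ = ⊥-elim (i≢j refl)
    rearrange d 1F 1F _  i≢j _ _ = ⊥-elim (i≢j refl)
    rearrange d 2F 2F _  i≢j _ _ = ⊥-elim (i≢j refl)
    rearrange d 0F _  0F _ i≢k _ = ⊥-elim (i≢k refl)
    rearrange d 1F _  1F _ i≢k _ = ⊥-elim (i≢k refl)
    rearrange d 2F _  2F _ i≢k _ = ⊥-elim (i≢k refl)
    rearrange d _  0F 0F _ _ j≢k = ⊥-elim (j≢k refl)
    rearrange d _  1F 1F _ _ j≢k = ⊥-elim (j≢k refl)
    rearrange d _  2F 2F _ _ j≢k = ⊥-elim (j≢k refl)

  S₃-invariant : ∀ (σ : Permutation′ 3) (d : Fin 3 → ℕ) →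
                 Q (d 0F) (d 1F) (d 2F) ⇔ Q (d (σ ⟨$⟩ʳ 0F)) (d (σ ⟨$⟩ʳ 1F)) (d (σ ⟨$⟩ʳ 2F))
  S₃-invariant σ d =
    rearrange d _ _ _ (σ-preserves-≢ λ ()) (σ-preserves-≢ λ ()) (σ-preserves-≢ λ ())
    where
    σ-preserves-≢ : ∀ {i j} → i ≢ j → σ ⟨$⟩ʳ i ≢ σ ⟨$⟩ʳ j
    σ-preserves-≢ i≢j = i≢j ∘ Injection.injective (Inverse⇒Injection σ)

module TSSCPP-Properties (n : ℕ) (1≤n : 1 ≤ n) (t : ℕ → ℕ → ℕ) (t-tsscpp : IsTSSCPP n t) where
  open Mirror n

  t≤m : ∀ {a b} → a < m → b < m → t a b ≤ m
  t≤m = proj₁ (proj₁ t-tsscpp) _ _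

  t-antitoneʳ : ∀ {a b b′} → a < m → b′ < m → b ≤ b′ → t a b′ ≤ t a b
  t-antitoneʳ = proj₁ (proj₂ (proj₁ t-tsscpp)) _ _ _

  t-antitoneˡ : ∀ {a a′ b} → a′ < m → b < m → a ≤ a′ → t a′ b ≤ t a b
  t-antitoneˡ = proj₂ (proj₂ (proj₁ t-tsscpp)) _ _ _

  t-complement : ∀ {a b} → a < m → b < m → t a b + t (mirror a) (mirror b) ≡ m
  t-complement = proj₂ (proj₂ t-tsscpp) _ _

  <t-swap₀₁ : ∀ {a b k} → a < m → b < m → k < t a b → k < t b a
  <t-swap₀₁ {a} {b} {k} a<m b<m k<t =
    proj₂ (proj₂ (to (proj₁ (proj₂ t-tsscpp) (transpose 0F 1F) (lookup (a ∷ b ∷ k ∷ [])))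
                     (a<m , b<m , k<t)))

  <t-swap₁₂ : ∀ {a b k} → a < m → b < m → k < m → k < t a b → b < t a k
  <t-swap₁₂ {a} {b} {k} a<m b<m k<m k<t =
    proj₂ (proj₂ (to (proj₁ (proj₂ t-tsscpp) (transpose 1F 2F) (lookup (a ∷ b ∷ k ∷ [])))
                     (a<m , b<m , k<t)))

  t-comm : ∀ {a b} → a < m → b < m → t a b ≡ t b a
  t-comm a<m b<m = ≡-by-lower-sets (t≤m a<m b<m) (t≤m b<m a<m)
    λ _ → mk⇔ (<t-swap₀₁ a<m b<m) (<t-swap₀₁ b<m a<m)

  n<m : n < m
  n<m = subst (n <_) (sym m≡n+n) (subst (_≤ n + n) (+-comm n 1) (+-monoʳ-≤ n 1≤n))

  t-centre≤n : t n n ≤ n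
  t-centre≤n = ≮⇒≥ λ n<t → <-irrefl refl (begin-strict
    n + n                            <⟨ +-mono-<-≤ n<t (≤-trans (<⇒≤ n<t) t≤t-mirror) ⟩
    t n n + t (mirror n) (mirror n)  ≡⟨ t-complement n<m n<m ⟩
    m                                ≡⟨ m≡n+n ⟩
    n + n                            ∎)
    where
    open ≤-Reasoning
    mn≤n : mirror n ≤ n
    mn≤n = <⇒≤ (high⇒mirror-low ≤-refl n<m)
    t≤t-mirror : t n n ≤ t (mirror n) (mirror n)
    t≤t-mirror = ≤-trans (t-antitoneˡ n<m n<m mn≤n) (t-antitoneʳ (mirror<m n<m) n<m mn≤n)

  t-high≤n : ∀ {p q} → n ≤ p → p < m → n ≤ q → q < m → t p q ≤ n
  t-high≤n {p} {q} n≤p p<m n≤q q<m = begin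
    t p q  ≤⟨ t-antitoneˡ p<m q<m n≤p ⟩
    t n q  ≤⟨ t-antitoneʳ n<m q<m n≤q ⟩
    t n n  ≤⟨ t-centre≤n ⟩
    n      ∎
    where open ≤-Reasoning

  n≤t-low : ∀ {a b} → a < n → b < n → n ≤ t a b
  n≤t-low {a} {b} a<n b<n = ≮⇒≥ λ t<n → <-irrefl refl (begin-strict
    m                                ≡⟨ sym (t-complement a<m b<m) ⟩
    t a b + t (mirror a) (mirror b)  <⟨ +-mono-<-≤ t<n (t-high≤n (low⇒mirror-high a<n) (mirror<m a<m)
                                                                 (low⇒mirror-high b<n) (mirror<m b<m)) ⟩
    n + n                            ≡⟨ sym m≡n+n ⟩
    m                                ∎)
    where
    open ≤-Reasoning
    a<m = <-trans a<n n<m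
    b<m = <-trans b<n n<m

  t-n-mirror≤ : ∀ {j} → j < n → t n (mirror j) ≤ j
  t-n-mirror≤ {j} j<n = ≮⇒≥ λ j<t → <-irrefl refl (begin-strict
    m                                       ≡⟨ sym (mirror+suc j<m) ⟩
    mirror j + suc j                        <⟨ +-mono-<-≤ (mj<t j<t) j<t ⟩
    t (mirror n) j + t n (mirror j)         ≡⟨ cong (λ x → t (mirror n) j + t x (mirror j))
                                                    (sym (mirror-involutive n<m)) ⟩
    t (mirror n) j + t (mirror (mirror n)) (mirror j)  ≡⟨ t-complement (mirror<m n<m) j<m ⟩
    m                                       ∎)
    where
    open ≤-Reasoning
    j<m = <-trans j<n n<m
    mj<t : j < t n (mirror j) → mirror j < t (mirror n) j
    mj<t j<t = ≤-trans (<t-swap₁₂ n<m (mirror<m j<m) j<m j<t)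
                       (t-antitoneˡ n<m j<m (<⇒≤ (high⇒mirror-low ≤-refl n<m)))

-- Rebuilding the cube set from its values on the quadrant [n, 2n)²

module Membership (n : ℕ) (τ : ℕ → ℕ → ℕ) (τ-comm : ∀ a b → τ a b ≡ τ b a) where
  open Mirror n

  high : ℕ → Bool
  high x = n ≤ᵇ x

  -- A cube with two high coordinates is read off τ; one with a single high
  -- coordinate is present iff its mirror image, which has two, is absent.
  member′ : Bool → Bool → Bool → ℕ → ℕ → ℕ → Bool
  member′ false false false a b c = true
  member′ true  true  true  a b c = false
  member′ true  true  false a b c = c <ᵇ τ a b
  member′ true  false true  a b c = b <ᵇ τ a c
  member′ false true  true  a b c = a <ᵇ τ b c
  member′ false false true  a b c = not (mirror c <ᵇ τ (mirror a) (mirror b))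
  member′ false true  false a b c = not (mirror b <ᵇ τ (mirror a) (mirror c))
  member′ true  false false a b c = not (mirror a <ᵇ τ (mirror b) (mirror c))

  member : ℕ → ℕ → ℕ → Bool
  member a b c = member′ (high a) (high b) (high c) a b c

  member-comm₀₁ : ∀ a b c → member a b c ≡ member b a c
  member-comm₀₁ a b c with high a | high b | high c
  ... | false | false | false = refl
  ... | false | false | true  rewrite τ-comm (mirror a) (mirror b) = refl
  ... | false | true  | false = refl
  ... | false | true  | true  = refl
  ... | true  | false | false = refl
  ... | true  | false | true  = refl
  ... | true  | true  | false rewrite τ-comm a b = refl
  ... | true  | true  | true  = refl

  member-comm₁₂ : ∀ a b c → member a b c ≡ member a c b
  member-comm₁₂ a b c with high a | high b | high c
  ... | false | false | false = refl
  ... | false | false | true  = refl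
  ... | false | true  | false = refl
  ... | false | true  | true  rewrite τ-comm b c = refl
  ... | true  | false | false rewrite τ-comm (mirror b) (mirror c) = refl
  ... | true  | false | true  = refl
  ... | true  | true  | false = refl
  ... | true  | true  | true  = refl

  data Side (x : ℕ) : Set where
    lo : x < n → high x ≡ false → high (mirror x) ≡ true  → Side x
    hi : n ≤ x → high x ≡ true  → high (mirror x) ≡ false → Side x

  side : ∀ x → x < m → Side x
  side x x<m with x <? n
  ... | yes x<n = lo x<n (≤ᵇ-false x<n) (≤ᵇ-true (low⇒mirror-high x<n))
  ... | no  x≮n = hi (≮⇒≥ x≮n) (≤ᵇ-true (≮⇒≥ x≮n)) (≤ᵇ-false (high⇒mirror-low (≮⇒≥ x≮n) x<m))

  member-mirror : ∀ {a b c} → a < m → b < m → c < m →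
                  member (mirror a) (mirror b) (mirror c) ≡ not (member a b c)
  member-mirror {a} {b} {c} a<m b<m c<m with side a a<m | side b b<m | side c c<m
  ... | lo _ ha hma | lo _ hb hmb | lo _ hc hmc rewrite ha | hb | hc | hma | hmb | hmc = refl
  ... | hi _ ha hma | hi _ hb hmb | hi _ hc hmc rewrite ha | hb | hc | hma | hmb | hmc = refl
  ... | lo _ ha hma | lo _ hb hmb | hi _ hc hmc rewrite ha | hb | hc | hma | hmb | hmc =
    sym (not-involutive _)
  ... | lo _ ha hma | hi _ hb hmb | lo _ hc hmc rewrite ha | hb | hc | hma | hmb | hmc =
    sym (not-involutive _)
  ... | hi _ ha hma | lo _ hb hmb | lo _ hc hmc rewrite ha | hb | hc | hma | hmb | hmc =
    sym (not-involutive _)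
  ... | hi _ ha hma | hi _ hb hmb | lo _ hc hmc rewrite ha | hb | hc | hma | hmb | hmc
    | mirror-involutive a<m | mirror-involutive b<m | mirror-involutive c<m = refl
  ... | hi _ ha hma | lo _ hb hmb | hi _ hc hmc rewrite ha | hb | hc | hma | hmb | hmc
    | mirror-involutive a<m | mirror-involutive b<m | mirror-involutive c<m = refl
  ... | lo _ ha hma | hi _ hb hmb | hi _ hc hmc rewrite ha | hb | hc | hma | hmb | hmc
    | mirror-involutive a<m | mirror-involutive b<m | mirror-involutive c<m = refl

  member-LLL : ∀ {a b c} → a < n → b < n → c < n → member a b c ≡ true
  member-LLL a<n b<n c<n rewrite ≤ᵇ-false a<n | ≤ᵇ-false b<n | ≤ᵇ-false c<n = refl

  member-HHH : ∀ {a b c} → n ≤ a → n ≤ b → n ≤ c → member a b c ≡ false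
  member-HHH n≤a n≤b n≤c rewrite ≤ᵇ-true n≤a | ≤ᵇ-true n≤b | ≤ᵇ-true n≤c = refl

  member-HHL : ∀ {a b c} → n ≤ a → n ≤ b → c < n → member a b c ≡ (c <ᵇ τ a b)
  member-HHL n≤a n≤b c<n rewrite ≤ᵇ-true n≤a | ≤ᵇ-true n≤b | ≤ᵇ-false c<n = refl

  member-HLH : ∀ {a b c} → n ≤ a → b < n → n ≤ c → member a b c ≡ (b <ᵇ τ a c)
  member-HLH n≤a b<n n≤c rewrite ≤ᵇ-true n≤a | ≤ᵇ-false b<n | ≤ᵇ-true n≤c = refl

  member-LHH : ∀ {a b c} → a < n → n ≤ b → n ≤ c → member a b c ≡ (a <ᵇ τ b c)
  member-LHH a<n n≤b n≤c rewrite ≤ᵇ-false a<n | ≤ᵇ-true n≤b | ≤ᵇ-true n≤c = refl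

  module Determined (1≤n : 1 ≤ n) (t : ℕ → ℕ → ℕ) (t-tsscpp : IsTSSCPP n t)
                    (τ≡t : ∀ {p q} → n ≤ p → p < m → n ≤ q → q < m → τ p q ≡ t p q) where
    open TSSCPP-Properties n 1≤n t t-tsscpp

    private
      <t⇔member-HHL : ∀ {a b k} → n ≤ a → a < m → n ≤ b → b < m → k < n →
                      (k < t a b ⇔ T (member a b k))
      <t⇔member-HHL {a} {b} {k} n≤a a<m n≤b b<m k<n
        rewrite member-HHL {a} {b} {k} n≤a n≤b k<n | τ≡t n≤a a<m n≤b b<m = ⇔.sym <ᵇ⇔<

      <t⇔member-HLH : ∀ {a b k} → n ≤ a → a < m → b < n → n ≤ k → k < m →
                      (k < t a b ⇔ T (member a b k))
      <t⇔member-HLH {a} {b} {k} n≤a a<m b<n n≤k k<m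
        rewrite member-HLH {a} {b} {k} n≤a b<n n≤k | τ≡t n≤a a<m n≤k k<m =
        ⇔.trans (mk⇔ (<t-swap₁₂ a<m b<m k<m) (<t-swap₁₂ a<m k<m b<m)) (⇔.sym <ᵇ⇔<)
        where b<m = <-≤-trans b<n n≤m

      <t⇔member-LHH : ∀ {a b k} → a < n → n ≤ b → b < m → n ≤ k → k < m →
                      (k < t a b ⇔ T (member a b k))
      <t⇔member-LHH {a} {b} {k} a<n n≤b b<m n≤k k<m
        rewrite member-LHH {a} {b} {k} a<n n≤b n≤k | τ≡t n≤b b<m n≤k k<m =
        ⇔.trans (mk⇔ (λ k<t → <t-swap₁₂ b<m a<m k<m (<t-swap₀₁ a<m b<m k<t))
                     (λ a<t → <t-swap₀₁ b<m a<m (<t-swap₁₂ b<m k<m a<m a<t)))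
                (⇔.sym <ᵇ⇔<)
        where a<m = <-≤-trans a<n n≤m

      via-mirror : ∀ {a b k} → a < m → b < m → k < m →
                   (mirror k < t (mirror a) (mirror b) ⇔ T (member (mirror a) (mirror b) (mirror k))) →
                   (k < t a b ⇔ T (member a b k))
      via-mirror {a} {b} {k} a<m b<m k<m mirrored =
        ⇔.trans (<⇔¬mirror< (t-complement a<m b<m) k<m)
       (⇔.trans (¬-cong-⇔ mirrored)
                (subst (λ x → (¬ T x) ⇔ T (member a b k)) (sym (member-mirror a<m b<m k<m))
                       (⇔.sym T⇔¬T-not)))

    <t⇔member : ∀ {a b k} → a < m → b < m → k < m → (k < t a b ⇔ T (member a b k))
    <t⇔member {a} {b} {k} a<m b<m k<m with a <? n | b <? n | k <? n
    ... | yes a<n | yes b<n | yes k<n rewrite member-LLL a<n b<n k<n =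
      mk⇔ (λ _ → tt) (λ _ → <-≤-trans k<n (n≤t-low a<n b<n))
    ... | no a≮n | no b≮n | no k≮n rewrite member-HHH (≮⇒≥ a≮n) (≮⇒≥ b≮n) (≮⇒≥ k≮n) =
      mk⇔ (λ k<t → <⇒≱ k<t (≤-trans (t-high≤n (≮⇒≥ a≮n) a<m (≮⇒≥ b≮n) b<m) (≮⇒≥ k≮n))) λ ()
    ... | no a≮n | no b≮n | yes k<n = <t⇔member-HHL (≮⇒≥ a≮n) a<m (≮⇒≥ b≮n) b<m k<n
    ... | no a≮n | yes b<n | no k≮n = <t⇔member-HLH (≮⇒≥ a≮n) a<m b<n (≮⇒≥ k≮n) k<m
    ... | yes a<n | no b≮n | no k≮n = <t⇔member-LHH a<n (≮⇒≥ b≮n) b<m (≮⇒≥ k≮n) k<m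
    ... | yes a<n | yes b<n | no k≮n = via-mirror a<m b<m k<m
      (<t⇔member-HHL (low⇒mirror-high a<n) (mirror<m a<m) (low⇒mirror-high b<n) (mirror<m b<m)
                     (high⇒mirror-low (≮⇒≥ k≮n) k<m))
    ... | yes a<n | no b≮n | yes k<n = via-mirror a<m b<m k<m
      (<t⇔member-HLH (low⇒mirror-high a<n) (mirror<m a<m) (high⇒mirror-low (≮⇒≥ b≮n) b<m)
                     (low⇒mirror-high k<n) (mirror<m k<m))
    ... | no a≮n | yes b<n | yes k<n = via-mirror a<m b<m k<m
      (<t⇔member-LHH (high⇒mirror-low (≮⇒≥ a≮n) a<m) (low⇒mirror-high b<n) (mirror<m b<m)
                     (low⇒mirror-high k<n) (mirror<m k<m))

  module Height
    (τ-antitone : ∀ {p q q′} → n ≤ p → p < m → n ≤ q → q ≤ q′ → q′ < m → τ p q′ ≤ τ p q)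
    (τ≤mirror : ∀ {p q} → n ≤ p → p < m → n ≤ q → q < m → τ p q ≤ mirror p)
    where

    private
      lo≰hi : ∀ {c c′} → c < n → n ≤ c′ → ¬ c′ ≤ c
      lo≰hi c<n n≤c′ c′≤c = <⇒≱ c<n (≤-trans n≤c′ c′≤c)

      antitone-LL : ∀ {a b c c′} → a < n → b < n → c < m → c′ ≤ c →
                    T (member a b c) → T (member a b c′)
      antitone-LL {a} {b} {c} {c′} a<n b<n c<m c′≤c with side c c<m | side c′ (≤-<-trans c′≤c c<m)
      ... | lo c<n _ _ | hi n≤c′ _ _ = ⊥-elim (lo≰hi c<n n≤c′ c′≤c)
      ... | _ | lo _ c′-low _ rewrite ≤ᵇ-false a<n | ≤ᵇ-false b<n | c′-low = λ _ → tt
      ... | hi _ c-high _ | hi _ c′-high _ rewrite ≤ᵇ-false a<n | ≤ᵇ-false b<n | c-high | c′-high =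
        ≮ᵇ-mono (mirror-antitone c′≤c) (≤-refl {τ (mirror a) (mirror b)})

      antitone-HL : ∀ {a b c c′} → n ≤ a → a < m → b < n → c < m → c′ ≤ c →
                    T (member a b c) → T (member a b c′)
      antitone-HL {a} {b} {c} {c′} n≤a a<m b<n c<m c′≤c with side c c<m | side c′ c′<m
        where c′<m = ≤-<-trans c′≤c c<m
      ... | lo c<n _ _ | hi n≤c′ _ _ = ⊥-elim (lo≰hi c<n n≤c′ c′≤c)
      ... | lo c<n c-low _ | lo c′<n c′-low _ rewrite ≤ᵇ-true n≤a | ≤ᵇ-false b<n | c-low | c′-low =
        ≮ᵇ-mono ≤-refl (τ-antitone (low⇒mirror-high b<n) (mirror<m b<m) (low⇒mirror-high c<n)
                                   (mirror-antitone c′≤c) (mirror<m (≤-<-trans c′≤c c<m)))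
        where b<m = <-≤-trans b<n n≤m
      ... | hi n≤c c-high _ | hi n≤c′ c′-high _ rewrite ≤ᵇ-true n≤a | ≤ᵇ-false b<n | c-high | c′-high =
        <ᵇ-mono ≤-refl (τ-antitone n≤a a<m n≤c′ c′≤c c<m)
      -- The bounds b < τ a c ≤ mirror a and mirror a < τ (mirror b) (mirror c′) ≤ b clash.
      ... | hi n≤c c-high _ | lo c′<n c′-low _ rewrite ≤ᵇ-true n≤a | ≤ᵇ-false b<n | c-high | c′-low =
        λ b<τ → from T-not⇔¬T λ ma<τ → <-irrefl refl (begin-strict
          mirror a                      <⟨ <ᵇ⇒< _ _ ma<τ ⟩
          τ (mirror b) (mirror c′)      ≤⟨ τ≤mirror (low⇒mirror-high b<n) (mirror<m b<m)
                                                    (low⇒mirror-high c′<n) (mirror<m (<-≤-trans c′<n n≤m)) ⟩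
          mirror (mirror b)             ≡⟨ mirror-involutive b<m ⟩
          b                             <⟨ <ᵇ⇒< _ _ b<τ ⟩
          τ a c                         ≤⟨ τ≤mirror n≤a a<m n≤c c<m ⟩
          mirror a                      ∎)
        where
        open ≤-Reasoning
        b<m = <-≤-trans b<n n≤m

      antitone-HH : ∀ {a b c c′} → n ≤ a → n ≤ b → c < m → c′ ≤ c →
                    T (member a b c) → T (member a b c′)
      antitone-HH {a} {b} {c} {c′} n≤a n≤b c<m c′≤c with side c c<m | side c′ (≤-<-trans c′≤c c<m)
      ... | lo c<n _ _ | hi n≤c′ _ _ = ⊥-elim (lo≰hi c<n n≤c′ c′≤c)
      ... | lo _ c-low _ | lo _ c′-low _ rewrite ≤ᵇ-true n≤a | ≤ᵇ-true n≤b | c-low | c′-low =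
        <ᵇ-mono c′≤c (≤-refl {τ a b})
      ... | hi _ c-high _ | _ rewrite ≤ᵇ-true n≤a | ≤ᵇ-true n≤b | c-high = λ ()

    member-antitone₃ : ∀ {a b c c′} → a < m → b < m → c < m → c′ ≤ c →
                       T (member a b c) → T (member a b c′)
    member-antitone₃ {a} {b} {c} {c′} a<m b<m c<m c′≤c with a <? n | b <? n
    ... | yes a<n | yes b<n = antitone-LL a<n b<n c<m c′≤c
    ... | no  a≮n | yes b<n = antitone-HL (≮⇒≥ a≮n) a<m b<n c<m c′≤c
    ... | no  a≮n | no  b≮n = antitone-HH (≮⇒≥ a≮n) (≮⇒≥ b≮n) c<m c′≤c
    ... | yes a<n | no  b≮n = λ abc →
      subst T (member-comm₀₁ b a c′)
            (antitone-HL (≮⇒≥ b≮n) b<m a<n c<m c′≤c (subst T (member-comm₀₁ a b c) abc))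

    member-antitone₂ : ∀ {a b b′ c} → a < m → b < m → c < m → b′ ≤ b →
                       T (member a b c) → T (member a b′ c)
    member-antitone₂ {a} {b} {b′} {c} a<m b<m c<m b′≤b abc =
      subst T (sym (member-comm₁₂ a b′ c))
            (member-antitone₃ a<m c<m b<m b′≤b (subst T (member-comm₁₂ a b c) abc))

    member-antitone₁ : ∀ {a a′ b c} → a < m → b < m → c < m → a′ ≤ a →
                       T (member a b c) → T (member a′ b c)
    member-antitone₁ {a} {a′} {b} {c} a<m b<m c<m a′≤a abc =
      subst T (sym (member-comm₀₁ a′ b c))
            (member-antitone₂ b<m a<m c<m a′≤a (subst T (member-comm₀₁ a b c) abc))

    height : ℕ → ℕ → ℕ
    height a b = count (member a b) m

    height≤m : ∀ a b → height a b ≤ m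
    height≤m a b = count≤ (member a b) m

    <height⇔ : ∀ {a b k} → a < m → b < m → k < m → (k < height a b ⇔ T (member a b k))
    <height⇔ {a} {b} a<m b<m =
      <count⇔ (member a b) m (λ j≤k k<m → member-antitone₃ a<m b<m k<m j≤k)

    height-antitoneʳ : ∀ {a b b′} → a < m → b′ < m → b ≤ b′ → height a b′ ≤ height a b
    height-antitoneʳ a<m b′<m b≤b′ =
      count-mono _ _ m (λ k<m → member-antitone₂ a<m b′<m k<m b≤b′)

    height-antitoneˡ : ∀ {a a′ b} → a′ < m → b < m → a ≤ a′ → height a′ b ≤ height a b
    height-antitoneˡ a′<m b<m a≤a′ =
      count-mono _ _ m (λ k<m → member-antitone₁ a′<m b<m k<m a≤a′)

    Occupied : ℕ → ℕ → ℕ → Set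
    Occupied a b c = a < m × b < m × c < m × T (member a b c)

    cube⇔occupied : ∀ d → Cube m height d ⇔ Occupied (d 0F) (d 1F) (d 2F)
    cube⇔occupied d = mk⇔
      (λ { (a<m , b<m , c<h) → a<m , b<m , <-≤-trans c<h (height≤m _ _)
                             , to (<height⇔ a<m b<m (<-≤-trans c<h (height≤m _ _))) c<h })
      (λ { (a<m , b<m , c<m , abc) → a<m , b<m , from (<height⇔ a<m b<m c<m) abc })

    height-symmetric : TotallySymmetric m height
    height-symmetric σ d =
      ⇔.trans (cube⇔occupied d)
     (⇔.trans (S₃-invariant Occupied swap₀₁ swap₁₂ σ d) (⇔.sym (cube⇔occupied (d ∘ (σ ⟨$⟩ʳ_)))))
      where
      swap₀₁ : ∀ {a b c} → Occupied a b c → Occupied b a c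
      swap₀₁ (a<m , b<m , c<m , abc) = b<m , a<m , c<m , subst T (member-comm₀₁ _ _ _) abc
      swap₁₂ : ∀ {a b c} → Occupied a b c → Occupied a c b
      swap₁₂ (a<m , b<m , c<m , abc) = a<m , c<m , b<m , subst T (member-comm₁₂ _ _ _) abc

    height-complement : ∀ {a b} → a < m → b < m → height a b + height (mirror a) (mirror b) ≡ m
    height-complement {a} {b} a<m b<m =
      trans (cong (height a b +_) mirrored) (m+[n∸m]≡n (height≤m a b))
      where
      member-mirror′ : ∀ {k} → k < m →
                       member (mirror a) (mirror b) k ≡ not (member a b (mirror k))
      member-mirror′ k<m = trans (cong (member (mirror a) (mirror b)) (sym (mirror-involutive k<m)))
                                 (member-mirror a<m b<m (mirror<m k<m))
      mirrored : height (mirror a) (mirror b) ≡ m ∸ height a b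
      mirrored = ≡-by-lower-sets (height≤m _ _) (m∸n≤m m (height a b)) λ {k} k<m →
        ⇔.trans (<height⇔ (mirror<m a<m) (mirror<m b<m) k<m)
       (⇔.trans (subst (λ x → T x ⇔ (¬ T (member a b (mirror k)))) (sym (member-mirror′ k<m))
                       T-not⇔¬T)
       (⇔.trans (¬-cong-⇔ (⇔.sym (<height⇔ a<m b<m (mirror<m k<m))))
                (⇔.sym (<⇔¬mirror< (m∸n+n≡m (height≤m a b)) k<m))))

    height-isTSSCPP : IsTSSCPP n height
    height-isTSSCPP =
        ( (λ a b _ _ → height≤m a b)
        , (λ _ _ _ a<m b′<m → height-antitoneʳ a<m b′<m)
        , (λ _ _ _ a′<m b<m → height-antitoneˡ a′<m b<m))
      , height-symmetric
      , (λ _ _ → height-complement)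

    height-quadrant : ∀ {p q} → n ≤ p → p < m → n ≤ q → q < m → τ p q ≤ n → height p q ≡ τ p q
    height-quadrant {p} {q} n≤p p<m n≤q q<m τ≤n =
      ≡-by-lower-sets (height≤m p q) (≤-trans τ≤n n≤m) λ {k} k<m →
        ⇔.trans (<height⇔ p<m q<m k<m) (member⇔ k)
      where
      member⇔ : ∀ k → T (member p q k) ⇔ k < τ p q
      member⇔ k with k <? n
      ... | yes k<n rewrite member-HHL {p} {q} {k} n≤p n≤q k<n = <ᵇ⇔<
      ... | no  k≮n rewrite member-HHH {p} {q} {k} n≤p n≤q (≮⇒≥ k≮n) =
        mk⇔ (λ ()) (λ k<τ → <⇒≱ (<-≤-trans k<τ τ≤n) (≮⇒≥ k≮n))

    height-unique : (1≤n : 1 ≤ n) (t : ℕ → ℕ → ℕ) (t-tsscpp : IsTSSCPP n t) →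
                    (∀ {p q} → n ≤ p → p < m → n ≤ q → q < m → τ p q ≡ t p q) →
                    ∀ {a b} → a < m → b < m → height a b ≡ t a b
    height-unique 1≤n t t-tsscpp τ≡t a<m b<m =
      ≡-by-lower-sets (height≤m _ _) (TSSCPP-Properties.t≤m n 1≤n t t-tsscpp a<m b<m) λ k<m →
        ⇔.trans (<height⇔ a<m b<m k<m)
                (⇔.sym (Determined.<t⇔member 1≤n t t-tsscpp τ≡t a<m b<m k<m))

-- From a tableau to a plane partition

row<entry : ∀ {n y} → IsSST n y → ∀ {i j} → InStaircase n i j → i < y i j
row<entry (positive , _ , _) {zero} {j} i+j<n = positive 0 j i+j<n
row<entry sst@(_ , _ , column-increasing) {suc i} {j} i+j<n =
  <-≤-trans (s≤s (row<entry sst (<-trans (n<1+n (i + j)) i+j<n)))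
            (column-increasing i (suc i) j i+j<n (n<1+n i))

module TableauToPP (n : ℕ) (y : ℕ → ℕ → ℕ) (y-sstn : IsSSTn n y) where
  open Mirror n

  private
    y≤n : ∀ {i j} → InStaircase n i j → y i j ≤ n
    y≤n = proj₁ (proj₂ y-sstn) _ _

    y-column : ∀ {i j} → InStaircase n (suc i) j → y i j < y (suc i) j
    y-column st = proj₂ (proj₂ (proj₁ y-sstn)) _ _ _ st (n<1+n _)

    y-diagonal : ∀ {i j} → InStaircase n (suc i) j → y (suc i) j ≤ y i (suc j) + 1
    y-diagonal = proj₂ (proj₂ y-sstn) _ _

  entry : ℕ → ℕ → ℕ
  entry p q = y (q ∸ p) (mirror q) ∸ suc (q ∸ p)

  τ : ℕ → ℕ → ℕ
  τ p q = if p ≤ᵇ q then entry p q else entry q p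

  τ-≤ : ∀ {p q} → p ≤ q → τ p q ≡ entry p q
  τ-≤ p≤q rewrite ≤ᵇ-true p≤q = refl

  τ-> : ∀ {p q} → q < p → τ p q ≡ entry q p
  τ-> q<p rewrite ≤ᵇ-false q<p = refl

  τ-comm : ∀ p q → τ p q ≡ τ q p
  τ-comm p q with <-cmp p q
  ... | tri< p<q _ _ = trans (τ-≤ (<⇒≤ p<q)) (sym (τ-> p<q))
  ... | tri≈ _ refl _ = refl
  ... | tri> _ _ q<p = trans (τ-> q<p) (sym (τ-≤ (<⇒≤ q<p)))

  τ-≥ : ∀ {p q} → q ≤ p → τ p q ≡ entry q p
  τ-≥ {p} {q} q≤p = trans (τ-comm p q) (τ-≤ q≤p)

  τ-step : ∀ {p q} → n ≤ p → p < m → n ≤ q → suc q < m → τ p (suc q) ≤ τ p q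
  τ-step {p} {q} n≤p p<m n≤q 1+q<m with p ≤? q
  ... | yes p≤q rewrite τ-≤ (m≤n⇒m≤1+n p≤q) | τ-≤ p≤q
                      | +-∸-assoc 1 p≤q | +-∸-assoc 1 1+q<m =
    ∸-monoˡ-≤ (suc (suc (q ∸ p)))
              (subst (y (suc (q ∸ p)) (mirror (suc q)) ≤_) (+-comm _ 1) (y-diagonal stair))
    where
    stair : InStaircase n (suc (q ∸ p)) (mirror (suc q))
    stair = subst (λ i → i + mirror (suc q) < n) (+-∸-assoc 1 p≤q)
                  (quadrant⇒staircase n≤p (m≤n⇒m≤1+n p≤q) 1+q<m)
  ... | no p≰q rewrite τ-≥ (≰⇒> p≰q) | τ-> (≰⇒> p≰q) | +-∸-assoc 1 (≰⇒> p≰q) =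
    ∸-monoˡ-≤ (suc (suc (p ∸ suc q))) (y-column stair)
    where
    stair : InStaircase n (suc (p ∸ suc q)) (mirror p)
    stair = subst (λ i → i + mirror p < n) (+-∸-assoc 1 (≰⇒> p≰q))
                  (quadrant⇒staircase n≤q (<⇒≤ (≰⇒> p≰q)) p<m)

  τ-antitone : ∀ {p q q′} → n ≤ p → p < m → n ≤ q → q ≤ q′ → q′ < m → τ p q′ ≤ τ p q
  τ-antitone {p} {q} {q′} n≤p p<m n≤q q≤q′ q′<m =
    subst (λ x → τ p x ≤ τ p q) (m∸n+n≡m q≤q′)
          (τ-antitone-+ (q′ ∸ q) (subst (_< m) (sym (m∸n+n≡m q≤q′)) q′<m))
    where
    τ-antitone-+ : ∀ d → d + q < m → τ p (d + q) ≤ τ p q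
    τ-antitone-+ zero    _       = ≤-refl
    τ-antitone-+ (suc d) 1+d+q<m = ≤-trans
      (τ-step n≤p p<m (≤-trans n≤q (m≤n+m q d)) 1+d+q<m)
      (τ-antitone-+ d (<-trans (n<1+n _) 1+d+q<m))

  τ≤mirror : ∀ {p q} → n ≤ p → p < m → n ≤ q → q < m → τ p q ≤ mirror p
  τ≤mirror {p} {q} n≤p p<m n≤q q<m = begin
    τ p q                       ≤⟨ τ-antitone n≤p p<m ≤-refl n≤q q<m ⟩
    τ p n                       ≡⟨ τ-≥ n≤p ⟩
    y i (mirror p) ∸ suc i      ≤⟨ ∸-monoˡ-≤ (suc i) (y≤n stair) ⟩
    n ∸ suc i                   ≡⟨ sym (mirror-≡ n-1-i+1+p≡m) ⟩
    mirror p                    ∎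
    where
    open ≤-Reasoning
    i = p ∸ n
    stair : InStaircase n i (mirror p)
    stair = quadrant⇒staircase ≤-refl n≤p p<m
    n-1-i+1+p≡m : n ∸ suc i + suc p ≡ m
    n-1-i+1+p≡m = begin-equality
      n ∸ suc i + suc p          ≡⟨ cong (λ x → n ∸ suc i + suc x) (sym (m∸n+n≡m n≤p)) ⟩
      n ∸ suc i + (suc i + n)    ≡⟨ sym (+-assoc (n ∸ suc i) (suc i) n) ⟩
      n ∸ suc i + suc i + n      ≡⟨ cong (_+ n) (m∸n+n≡m (≤-<-trans (m≤m+n i _) stair)) ⟩
      n + n                      ≡⟨ sym m≡n+n ⟩
      m                          ∎

  τ≤n : ∀ {p q} → n ≤ p → p < m → n ≤ q → q < m → τ p q ≤ n
  τ≤n n≤p p<m n≤q q<m = ≤-trans (τ≤mirror n≤p p<m n≤q q<m) (<⇒≤ (high⇒mirror-low n≤p p<m))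

  open Membership n τ τ-comm public
  open Height τ-antitone τ≤mirror public

  height+row≡y : ∀ {i j} → InStaircase n i j → height (mirror (i + j)) (mirror j) + suc i ≡ y i j
  height+row≡y {i} {j} i+j<n = begin
    height p q + suc i                              ≡⟨ cong (_+ suc i) (height-quadrant n≤p p<m n≤q q<m
                                                                          (τ≤n n≤p p<m n≤q q<m)) ⟩
    τ p q + suc i                                   ≡⟨ cong (_+ suc i) (τ-≤ p≤q) ⟩
    y (q ∸ p) (mirror q) ∸ suc (q ∸ p) + suc i      ≡⟨ cong₂ (λ a b → y a b ∸ suc a + suc i)
                                                            (mirror-∸ i+j<m) (mirror-involutive j<m) ⟩
    y i j ∸ suc i + suc i                           ≡⟨ m∸n+n≡m (row<entry (proj₁ y-sstn) i+j<n) ⟩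
    y i j                                           ∎
    where
    open ≡-Reasoning
    i+j<m = <-≤-trans i+j<n n≤m
    j<m   = ≤-<-trans (m≤n+m j i) i+j<m
    p = mirror (i + j)
    q = mirror j
    p≤q = mirror-antitone (m≤n+m j i)
    n≤p = low⇒mirror-high i+j<n
    n≤q = ≤-trans n≤p p≤q
    q<m = mirror<m j<m
    p<m = ≤-<-trans p≤q q<m

-- From a plane partition to a tableau

module PPToTableau (n : ℕ) (1≤n : 1 ≤ n) (t : ℕ → ℕ → ℕ) (t-tsscpp : IsTSSCPP n t) where
  open Mirror n
  open TSSCPP-Properties n 1≤n t t-tsscpp

  tableau : ℕ → ℕ → ℕ
  tableau i j = t (mirror (i + j)) (mirror j) + suc i

  private
    mirror-stair<m : ∀ i j → InStaircase n i j → mirror (i + j) < m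
    mirror-stair<m i j i+j<n = mirror<m (<-≤-trans i+j<n n≤m)

    mirror-col<m : ∀ i j → InStaircase n i j → mirror j < m
    mirror-col<m i j i+j<n = mirror<m (<-≤-trans (≤-<-trans (m≤n+m j i) i+j<n) n≤m)

    t-stair-antitoneˡ : ∀ {i i′ j} → InStaircase n i′ j → i ≤ i′ →
                        t (mirror (i + j)) (mirror j) ≤ t (mirror (i′ + j)) (mirror j)
    t-stair-antitoneˡ {i} {i′} {j} i′+j<n i≤i′ =
      t-antitoneˡ (mirror-stair<m i j (≤-<-trans (+-monoˡ-≤ j i≤i′) i′+j<n)) (mirror-col<m i′ j i′+j<n)
                  (mirror-antitone (+-monoˡ-≤ j i≤i′))

  tableau-isSSTn : IsSSTn n tableau
  tableau-isSSTn = (positive , row , column) , bounded , diagonal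
    where
    positive : ∀ i j → InStaircase n i j → 1 ≤ tableau i j
    positive i j _ = ≤-trans (s≤s z≤n) (m≤n+m (suc i) _)

    row : ∀ i j j′ → InStaircase n i j′ → j ≤ j′ → tableau i j ≤ tableau i j′
    row i j j′ i+j′<n j≤j′ = +-monoˡ-≤ (suc i) (≤-trans
      (t-antitoneˡ (mirror-stair<m i j i+j<n) (mirror-col<m i j i+j<n) (mirror-antitone (+-monoʳ-≤ i j≤j′)))
      (t-antitoneʳ (mirror-stair<m i j′ i+j′<n) (mirror-col<m i j i+j<n) (mirror-antitone j≤j′)))
      where i+j<n = ≤-<-trans (+-monoʳ-≤ i j≤j′) i+j′<n

    column : ∀ i i′ j → InStaircase n i′ j → i < i′ → tableau i j < tableau i′ j
    column i i′ j i′+j<n i<i′ = +-mono-≤-< (t-stair-antitoneˡ i′+j<n (<⇒≤ i<i′)) (s≤s i<i′)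

    bounded : ∀ i j → InStaircase n i j → tableau i j ≤ n
    bounded i j i+j<n = begin
      t (mirror (i + j)) (mirror j) + suc i  ≤⟨ +-monoˡ-≤ (suc i) (≤-trans
          (t-antitoneˡ (mirror-stair<m i j i+j<n) (mirror-col<m i j i+j<n) (low⇒mirror-high i+j<n))
          (t-n-mirror≤ (≤-<-trans (m≤n+m j i) i+j<n))) ⟩
      j + suc i                              ≡⟨ +-suc j i ⟩
      suc (j + i)                            ≡⟨ cong suc (+-comm j i) ⟩
      suc (i + j)                            ≤⟨ i+j<n ⟩
      n                                      ∎
      where open ≤-Reasoning

    diagonal : ∀ i j → InStaircase n (suc i) j → tableau (suc i) j ≤ tableau i (suc j) + 1
    diagonal i j 1+i+j<n = begin
      t P (mirror j) + suc (suc i)         ≤⟨ +-monoˡ-≤ (suc (suc i))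
          (t-antitoneʳ (mirror-stair<m (suc i) j 1+i+j<n) (mirror-col<m (suc i) j 1+i+j<n) (mirror-antitone (n≤1+n j))) ⟩
      t P (mirror (suc j)) + suc (suc i)   ≡⟨ solve 2 (λ x i → x :+ (con 2 :+ i) := x :+ (con 1 :+ i) :+ con 1)
                                                  refl (t P (mirror (suc j))) i ⟩
      t P (mirror (suc j)) + suc i + 1     ≡⟨ cong (λ x → t (mirror x) (mirror (suc j)) + suc i + 1)
                                                   (sym (+-suc i j)) ⟩
      tableau i (suc j) + 1                ∎
      where
      open ≤-Reasoning
      P = mirror (suc (i + j))

  module _ {y : ℕ → ℕ → ℕ} (y-sstn : IsSSTn n y)
           (agree : ∀ {i j} → InStaircase n i j → y i j ≡ tableau i j) where
    open TableauToPP n y y-sstn using (τ; τ-≤; τ-comm)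

    private
      τ≡t-≤ : ∀ {p q} → n ≤ p → p ≤ q → q < m → τ p q ≡ t p q
      τ≡t-≤ {p} {q} n≤p p≤q q<m = begin
        τ p q                                           ≡⟨ τ-≤ p≤q ⟩
        y i j ∸ suc i                                   ≡⟨ cong (_∸ suc i) (agree stair) ⟩
        t (mirror (i + j)) (mirror j) + suc i ∸ suc i   ≡⟨ m+n∸n≡m _ (suc i) ⟩
        t (mirror (i + j)) (mirror j)                   ≡⟨ cong₂ t (mirror-quadrant p≤q q<m)
                                                                   (mirror-involutive q<m) ⟩
        t p q                                           ∎
        where
        open ≡-Reasoning
        i = q ∸ p
        j = mirror q
        stair = quadrant⇒staircase n≤p p≤q q<m

    τ≡t : ∀ {p q} → n ≤ p → p < m → n ≤ q → q < m → τ p q ≡ t p q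
    τ≡t {p} {q} n≤p p<m n≤q q<m with p ≤? q
    ... | yes p≤q = τ≡t-≤ n≤p p≤q q<m
    ... | no  p≰q = begin
      τ p q  ≡⟨ τ-comm p q ⟩
      τ q p  ≡⟨ τ≡t-≤ n≤q (<⇒≤ (≰⇒> p≰q)) p<m ⟩
      t q p  ≡⟨ t-comm q<m p<m ⟩
      t p q  ∎
      where open ≡-Reasoning

module Bijection (n : ℕ) (1≤n : 1 ≤ n) where
  open Mirror n
  module PP  = Setoid (TSSCPP-setoid n)
  module SST = Setoid (SSTn-setoid n)

  toSST : TSSCPP n → SSTn n
  toSST (t , t-tsscpp) = PPToTableau.tableau n 1≤n t t-tsscpp , PPToTableau.tableau-isSSTn n 1≤n t t-tsscpp

  fromSST : SSTn n → TSSCPP n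
  fromSST (y , y-sstn) = TableauToPP.height n y y-sstn , TableauToPP.height-isTSSCPP n y y-sstn

  toSST-cong : ∀ s s′ → s PP.≈ s′ → toSST s SST.≈ toSST s′
  toSST-cong _ _ s≈s′ i j i+j<n =
    cong (_+ suc i) (s≈s′ _ _ (mirror<m (<-≤-trans i+j<n n≤m)) (mirror<m j<m))
    where j<m = <-≤-trans (≤-<-trans (m≤n+m j i) i+j<n) n≤m

  toSST∘fromSST : ∀ y → toSST (fromSST y) SST.≈ y
  toSST∘fromSST (y , y-sstn) _ _ = TableauToPP.height+row≡y n y y-sstn

  fromSST-inverse : ∀ s y → y SST.≈ toSST s → fromSST y PP.≈ s
  fromSST-inverse (t , t-tsscpp) (y , y-sstn) y≈toSST-s _ _ =
    TableauToPP.height-unique n y y-sstn 1≤n t t-tsscpp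
      (PPToTableau.τ≡t n 1≤n t t-tsscpp y-sstn (y≈toSST-s _ _))

  toSST-inverse : ∀ y s → s PP.≈ fromSST y → toSST s SST.≈ y
  toSST-inverse y s s≈fromSST-y =
    SST.trans {toSST s} {toSST (fromSST y)} {y} (toSST-cong s (fromSST y) s≈fromSST-y) (toSST∘fromSST y)

  fromSST-cong : ∀ y y′ → y SST.≈ y′ → fromSST y PP.≈ fromSST y′
  fromSST-cong y y′ y≈y′ = fromSST-inverse (fromSST y′) y
    (SST.trans {y} {y′} {toSST (fromSST y′)} y≈y′ (SST.sym {toSST (fromSST y′)} {y′} (toSST∘fromSST y′)))

theorem3 : (n : ℕ) → 1 ≤ n → Inverse (TSSCPP-setoid n) (SSTn-setoid n)
theorem3 n 1≤n = record
  { to        = toSST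
  ; from      = fromSST
  ; to-cong   = λ {s} {s′} → toSST-cong s s′
  ; from-cong = λ {y} {y′} → fromSST-cong y y′
  ; inverse   = (λ {y} {s} → toSST-inverse y s) , (λ {s} {y} → fromSST-inverse s y)
  }
  where open Bijection n 1≤n
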